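{- Let $\mathcal W$ be a category with terminal object $\top$, $\mathcal V$ a category, $U\in\mathcal V$, and let $-\ltimes U:\mathcal W\to\mathcal V$ be a non-spooky multiplier for $U$. Let $\Psi$ be a presheaf on $\mathcal W$. Then for every presheaf $\Gamma$ on $\int_{\mathcal W}\Psi$, the restriction $\iota^*(T^\Psi_U\Gamma)$ of the transpension $T^\Psi_U\Gamma$ to the full subcategory $\int_{\mathcal V}(\Psi\ltimes\partial U)$ is the terminal presheaf, i.e. each of its components is a singleton.
   Context: A multiplier for $U$ is a functor $-\ltimes U:\mathcal W\to\mathcal V$ together with an isomorphism $\top\ltimes U\cong U$; for $W\in\mathcal W$ the second projection $\pi_2:W\ltimes U\to U$ is $(!_W\ltimes U)$ followed by this isomorphism. It is non-spooky if every $\pi_2:W\ltimes U\to U$ is split epi. A morphism $\varphi:V\to U$ in $\mathcal V$ is dimensionally split if there are $W\in\mathcal W$ and $\chi:W\ltimes U\to V$ with $\varphi\circ\chi=\pi_2$. Presheaves on a category $\mathcal C$ are functors $\mathcal C^{op}\to\mathrm{Set}$; $\mathbf y$ is the Yoneda embedding; $\int_{\mathcal C}\Gamma$ is the category of elements of $\Gamma$ (objects $(C,\gamma)$ with $\gamma\in\Gamma(C)$, morphisms $f:C\to C'$ with $\gamma'\cdot f=\gamma$). For a presheaf $\Psi$ on $\mathcal W$, $\Psi\ltimes\mathbf yU$ is the presheaf on $\mathcal V$ with $(\Psi\ltimes\mathbf yU)(V)=\int^{W\in\mathcal W}\mathcal V(V,W\ltimes U)\times\Psi(W)$ (left Kan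 extension of $-\ltimes U$ along Yoneda); the class of $(\chi,\psi)$ is written $(\psi\ltimes\mathbf yU)\circ\chi$. The map $\pi_2:\Psi\ltimes\mathbf yU\to\mathbf yU$ sends $(\psi\ltimes\mathbf yU)\circ\chi$ to $\pi_2\circ\chi$. The boundary $\partial U\subseteq\mathbf yU$ is the subpresheaf with $\partial U(V)=\{\varphi:V\to U\mid\varphi$ not dimensionally split$\}$, and $\Psi\ltimes\partial U\subseteq\Psi\ltimes\mathbf yU$ is its preimage under $\pi_2$; thus $\int_{\mathcal V}(\Psi\ltimes\partial U)$ is the full subcategory of $\int_{\mathcal V}(\Psi\ltimes\mathbf yU)$ on objects $(V,\varphi)$ with $\pi_2\circ\varphi$ not dimensionally split, with inclusion $\iota$, and $\iota^*$ is restriction of presheaves. The functor $\mathrm{Fr}^\Psi_U:\int_{\mathcal W}\Psi\to\int_{\mathcal V}(\Psi\ltimes\mathbf yU)$ sends $(W,\psi)$ to $(W\ltimes U,(\psi\ltimes\mathbf yU)\circ\mathrm{id})$ and $f$ to $f\ltimes U$. The transpension $T^\Psi_U$ is the right adjoint of precomposition $(\mathrm{Fr}^\Psi_U)^*$, explicitly $(T^\Psi_U\Gamma)(V,\varphi)=\mathrm{Hom}\big((\mathrm{Fr}^\Psi_U)^*\mathbf y(V,\varphi),\Gamma\big)$. -}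

module Defs where

open import Level using (Level; suc; _⊔_)
open import Data.Product using (Σ; Σ-syntax; _,_; proj₁; proj₂; _×_)
open import Relation.Nullary using (¬_)
open import Relation.Binary.Bundles using (Setoid)
open import Relation.Binary.Structures using (IsEquivalence)
open import Relation.Binary.Core using (Rel)
import Relation.Binary.Construct.Closure.Equivalence as EqC
open import Relation.Binary.Construct.Closure.ReflexiveTransitive using (Star; ε; _◅_)
open import Relation.Binary.Construct.Closure.Symmetric using (SymClosure; fwd; bwd)

-- Hom-sets carry an equivalence relation
-- (setoid-enriched categories), which is the standard constructive rendering.

record Category (ℓ : Level) : Set (suc ℓ) where
  infixr 9 _∘_
  infix 4 _≈_
  field
    Obj : Set ℓ
    _⇒_ : Obj → Obj → Set ℓ
    _≈_ : ∀ {A B} → Rel (A ⇒ B) ℓ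
    id  : ∀ {A} → A ⇒ A
    _∘_ : ∀ {A B C} → B ⇒ C → A ⇒ B → A ⇒ C
    equiv     : ∀ {A B} → IsEquivalence (_≈_ {A} {B})
    ∘-resp-≈  : ∀ {A B C} {f h : B ⇒ C} {g i : A ⇒ B} → f ≈ h → g ≈ i → f ∘ g ≈ h ∘ i
    identityˡ : ∀ {A B} {f : A ⇒ B} → id ∘ f ≈ f
    identityʳ : ∀ {A B} {f : A ⇒ B} → f ∘ id ≈ f
    assoc     : ∀ {A B C D} {f : A ⇒ B} {g : B ⇒ C} {h : C ⇒ D} → (h ∘ g) ∘ f ≈ h ∘ (g ∘ f)

  module Equiv {A B : Obj} = IsEquivalence (equiv {A} {B})

  hom-setoid : Obj → Obj → Setoid ℓ ℓ
  hom-setoid A B = record { Carrier = A ⇒ B ; _≈_ = _≈_ ; isEquivalence = equiv }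

record Functor {ℓ : Level} (C D : Category ℓ) : Set ℓ where
  private
    module C = Category C
    module D = Category D
  field
    F₀ : C.Obj → D.Obj
    F₁ : ∀ {A B} → A C.⇒ B → F₀ A D.⇒ F₀ B
    identity     : ∀ {A} → F₁ (C.id {A}) D.≈ D.id
    homomorphism : ∀ {A B C'} {f : A C.⇒ B} {g : B C.⇒ C'} → F₁ (g C.∘ f) D.≈ F₁ g D.∘ F₁ f
    F-resp-≈     : ∀ {A B} {f g : A C.⇒ B} → f C.≈ g → F₁ f D.≈ F₁ g

record Terminal {ℓ : Level} (C : Category ℓ) : Set ℓ where
  open Category C
  field
    ⊤        : Obj
    !        : ∀ {A} → A ⇒ ⊤
    !-unique : ∀ {A} (f : A ⇒ ⊤) → ! ≈ f

record _≅_ {ℓ : Level} {C : Category ℓ} (A B : Category.Obj C) : Set ℓ where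
  open Category C
  field
    from : A ⇒ B
    to   : B ⇒ A
    isoˡ : to ∘ from ≈ id
    isoʳ : from ∘ to ≈ id

IsSplitEpi : ∀ {ℓ} (C : Category ℓ) {A B : Category.Obj C} → Category._⇒_ C A B → Set ℓ
IsSplitEpi C {A} {B} e = Σ[ s ∈ B ⇒ A ] (e ∘ s ≈ id)
  where open Category C

record Multiplier {ℓ : Level} (𝒲 : Category ℓ) (⊤𝒲 : Terminal 𝒲)
                  (𝒱 : Category ℓ) (U : Category.Obj 𝒱) : Set ℓ where
  field
    ⋉U    : Functor 𝒲 𝒱
    unitor : _≅_ {C = 𝒱} (Functor.F₀ ⋉U (Terminal.⊤ ⊤𝒲)) U
  open Functor ⋉U public
  open _≅_ unitor public

module _ {ℓ} {𝒲 : Category ℓ} {⊤𝒲 : Terminal 𝒲} {𝒱 : Category ℓ} {U : Category.Obj 𝒱}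
         (M : Multiplier 𝒲 ⊤𝒲 𝒱 U) where
  private
    module 𝒲 = Category 𝒲
    module 𝒱 = Category 𝒱
    module M = Multiplier M
  open Terminal ⊤𝒲

  π₂ : (W : 𝒲.Obj) → M.F₀ W 𝒱.⇒ U
  π₂ W = M.from 𝒱.∘ M.F₁ (! {W})

  NonSpooky : Set ℓ
  NonSpooky = ∀ (W : 𝒲.Obj) → IsSplitEpi 𝒱 (π₂ W)

  DimensionallySplit : ∀ {V : 𝒱.Obj} → V 𝒱.⇒ U → Set ℓ
  DimensionallySplit {V} φ = Σ[ W ∈ 𝒲.Obj ] Σ[ χ ∈ M.F₀ W 𝒱.⇒ V ] (φ 𝒱.∘ χ 𝒱.≈ π₂ W)

record Presheaf {ℓ : Level} (C : Category ℓ) : Set (suc ℓ) where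
  open Category C
  field
    F₀  : Obj → Setoid ℓ ℓ
  module F₀ (A : Obj) = Setoid (F₀ A)
  field
    act        : ∀ {A B} → A ⇒ B → Setoid.Carrier (F₀ B) → Setoid.Carrier (F₀ A)
    act-cong   : ∀ {A B} (f : A ⇒ B) {x y} → F₀._≈_ B x y → F₀._≈_ A (act f x) (act f y)
    act-resp-≈ : ∀ {A B} {f g : A ⇒ B} (x : Setoid.Carrier (F₀ B)) → f ≈ g → F₀._≈_ A (act f x) (act g x)
    act-id     : ∀ {A} (x : Setoid.Carrier (F₀ A)) → F₀._≈_ A (act id x) x
    act-∘      : ∀ {A B C'} (f : A ⇒ B) (g : B ⇒ C') (x : Setoid.Carrier (F₀ C')) →
                 F₀._≈_ A (act (g ∘ f) x) (act f (act g x))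

  ∣_∣ : Obj → Set ℓ
  ∣ A ∣ = Setoid.Carrier (F₀ A)

record NatTrans {ℓ : Level} {C : Category ℓ} (P Q : Presheaf C) : Set ℓ where
  open Category C
  private
    module P = Presheaf P
    module Q = Presheaf Q
  field
    η       : ∀ A → P.∣ A ∣ → Q.∣ A ∣
    η-cong  : ∀ A {x y} → P.F₀._≈_ A x y → Q.F₀._≈_ A (η A x) (η A y)
    natural : ∀ {A B} (f : A ⇒ B) (x : P.∣ B ∣) → Q.F₀._≈_ A (η A (P.act f x)) (Q.act f (η B x))

PshHom : ∀ {ℓ} {C : Category ℓ} → Presheaf C → Presheaf C → Setoid ℓ ℓ
PshHom {C = C} P Q = record
  { Carrier = NatTrans P Q
  ; _≈_ = λ α β → ∀ A (x : P.∣ A ∣) → Q.F₀._≈_ A (NatTrans.η α A x) (NatTrans.η β A x)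
  ; isEquivalence = record
    { refl  = λ A x → Q.F₀.refl A
    ; sym   = λ p A x → Q.F₀.sym A (p A x)
    ; trans = λ p q A x → Q.F₀.trans A (p A x) (q A x) } }
  where
    module P = Presheaf P
    module Q = Presheaf Q

IsSingleton : ∀ {ℓ} → Setoid ℓ ℓ → Set ℓ
IsSingleton S = Σ[ c ∈ Carrier ] (∀ x → x ≈ c)
  where open Setoid S

IsTerminalPsh : ∀ {ℓ} {C : Category ℓ} → Presheaf C → Set ℓ
IsTerminalPsh {C = C} P = ∀ (A : Category.Obj C) → IsSingleton (Presheaf.F₀ P A)

𝐲 : ∀ {ℓ} {C : Category ℓ} → Category.Obj C → Presheaf C
𝐲 {C = C} B = record
  { F₀ = λ A → hom-setoid A B
  ; act = λ f g → g ∘ f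
  ; act-cong = λ f p → ∘-resp-≈ p Equiv.refl
  ; act-resp-≈ = λ g p → ∘-resp-≈ Equiv.refl p
  ; act-id = λ g → identityʳ
  ; act-∘ = λ f g h → Equiv.sym assoc }
  where open Category C

_^* : ∀ {ℓ} {C D : Category ℓ} → Functor C D → Presheaf D → Presheaf C
_^* {C = C} {D} F P = record
  { F₀ = λ A → P.F₀ (F.F₀ A)
  ; act = λ f → P.act (F.F₁ f)
  ; act-cong = λ f → P.act-cong (F.F₁ f)
  ; act-resp-≈ = λ x p → P.act-resp-≈ x (F.F-resp-≈ p)
  ; act-id = λ {A} x → P.F₀.trans (F.F₀ A) (P.act-resp-≈ x F.identity) (P.act-id x)
  ; act-∘ = λ {A} f g x → P.F₀.trans (F.F₀ A) (P.act-resp-≈ x F.homomorphism) (P.act-∘ (F.F₁ f) (F.F₁ g) x) }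
  where
    module F = Functor F
    module P = Presheaf P
infix 20 _^*

∫ : ∀ {ℓ} (C : Category ℓ) → Presheaf C → Category ℓ
∫ C P = record
  { Obj = Σ[ A ∈ Obj ] P.∣ A ∣
  ; _⇒_ = λ { (A , a) (B , b) → Σ[ f ∈ A ⇒ B ] P.F₀._≈_ A (P.act f b) a }
  ; _≈_ = λ f g → proj₁ f ≈ proj₁ g
  ; id = λ { {A , a} → id , P.act-id a }
  ; _∘_ = λ { {A , a} {B , b} {C' , c} (g , q) (f , p) →
              g ∘ f , P.F₀.trans A (P.act-∘ f g c) (P.F₀.trans A (P.act-cong f q) p) }
  ; equiv = record { refl = Equiv.refl ; sym = Equiv.sym ; trans = Equiv.trans }
  ; ∘-resp-≈ = ∘-resp-≈
  ; identityˡ = identityˡ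
  ; identityʳ = identityʳ
  ; assoc = assoc }
  where
    open Category C
    module P = Presheaf P

FullSub : ∀ {ℓ} (C : Category ℓ) → (Category.Obj C → Set ℓ) → Category ℓ
FullSub C Pr = record
  { Obj = Σ Obj Pr
  ; _⇒_ = λ a b → proj₁ a ⇒ proj₁ b
  ; _≈_ = _≈_ ; id = id ; _∘_ = _∘_ ; equiv = equiv ; ∘-resp-≈ = ∘-resp-≈
  ; identityˡ = identityˡ ; identityʳ = identityʳ ; assoc = assoc }
  where open Category C

ι : ∀ {ℓ} (C : Category ℓ) (Pr : Category.Obj C → Set ℓ) → Functor (FullSub C Pr) C
ι C Pr = record
  { F₀ = proj₁ ; F₁ = λ f → f ; identity = Equiv.refl ; homomorphism = Equiv.refl
  ; F-resp-≈ = λ p → p }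
  where open Category C

-- The presheaf  Ψ ⋉ 𝐲U  on 𝒱 (left Kan extension of  -⋉U  along Yoneda),
-- as the coend  ∫^W 𝒱(V, W⋉U) × Ψ(W), presented as a setoid quotient.

module Transpension {ℓ} {𝒲 : Category ℓ} {⊤𝒲 : Terminal 𝒲} {𝒱 : Category ℓ} {U : Category.Obj 𝒱}
                    (M : Multiplier 𝒲 ⊤𝒲 𝒱 U) (Ψ : Presheaf 𝒲) where
  private
    module 𝒲 = Category 𝒲
    module 𝒱 = Category 𝒱
    module M = Multiplier M
    module Ψ = Presheaf Ψ

  -- representatives of elements of (Ψ ⋉ 𝐲U)(V): triples (W , χ : V → W⋉U , ψ ∈ Ψ(W)),
  -- i.e. the expression (ψ ⋉ 𝐲U) ∘ χ
  Rep : 𝒱.Obj → Set ℓ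
  Rep V = Σ[ W ∈ 𝒲.Obj ] (V 𝒱.⇒ M.F₀ W) × Ψ.∣ W ∣

  data Step {V : 𝒱.Obj} : Rep V → Rep V → Set ℓ where
    hom  : ∀ {W} {χ χ' : V 𝒱.⇒ M.F₀ W} {ψ} → χ 𝒱.≈ χ' → Step (W , χ , ψ) (W , χ' , ψ)
    elem : ∀ {W} {χ : V 𝒱.⇒ M.F₀ W} {ψ ψ'} → Ψ.F₀._≈_ W ψ ψ' → Step (W , χ , ψ) (W , χ , ψ')
    -- (Ψ(f) ψ' ⋉ 𝐲U) ∘ χ  =  (ψ' ⋉ 𝐲U) ∘ ((f ⋉ U) ∘ χ)
    zig  : ∀ {W W'} (f : W 𝒲.⇒ W') {χ : V 𝒱.⇒ M.F₀ W} {χ' : V 𝒱.⇒ M.F₀ W'} (ψ' : Ψ.∣ W' ∣) →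
           χ' 𝒱.≈ M.F₁ f 𝒱.∘ χ → Step (W , χ , Ψ.act f ψ') (W' , χ' , ψ')

  Coend : 𝒱.Obj → Setoid ℓ ℓ
  Coend V = EqC.setoid (Step {V})

  private
    reind : ∀ {V V'} (g : V' 𝒱.⇒ V) → Rep V → Rep V'
    reind g (W , χ , ψ) = W , χ 𝒱.∘ g , ψ

    reind-step : ∀ {V V'} (g : V' 𝒱.⇒ V) {x y} → Step x y → Step (reind g x) (reind g y)
    reind-step g (hom p) = hom (𝒱.∘-resp-≈ p 𝒱.Equiv.refl)
    reind-step g (elem p) = elem p
    reind-step g (zig f ψ' p) = zig f ψ' (𝒱.Equiv.trans (𝒱.∘-resp-≈ p 𝒱.Equiv.refl) 𝒱.assoc)

    one : ∀ {V} {x y : Rep V} → Step x y → EqC.EqClosure Step x y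
    one s = fwd s ◅ ε

  Ψ⋉𝐲U : Presheaf 𝒱
  Ψ⋉𝐲U = record
    { F₀ = Coend
    ; act = reind
    ; act-cong = λ g → EqC.gmap (reind g) (reind-step g)
    ; act-resp-≈ = λ x p → one (hom (𝒱.∘-resp-≈ 𝒱.Equiv.refl p))
    ; act-id = λ x → one (hom 𝒱.identityʳ)
    ; act-∘ = λ f g x → one (hom (𝒱.Equiv.sym 𝒱.assoc)) }

  π₂ᶜ : ∀ {V} → Rep V → V 𝒱.⇒ U
  π₂ᶜ (W , χ , ψ) = π₂ M W 𝒱.∘ χ

  ∫Ψ⋉𝐲U : Category ℓ
  ∫Ψ⋉𝐲U = ∫ 𝒱 Ψ⋉𝐲U

  -- objects of ∫_𝒱 (Ψ ⋉ ∂U):  (V , φ) with π₂ ∘ φ not dimensionally split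
  In∂ : Category.Obj ∫Ψ⋉𝐲U → Set ℓ
  In∂ (V , φ) = ¬ DimensionallySplit M (π₂ᶜ φ)

  ∫Ψ⋉∂U : Category ℓ
  ∫Ψ⋉∂U = FullSub ∫Ψ⋉𝐲U In∂

  ι∂ : Functor ∫Ψ⋉∂U ∫Ψ⋉𝐲U
  ι∂ = ι ∫Ψ⋉𝐲U In∂

  ∫Ψ : Category ℓ
  ∫Ψ = ∫ 𝒲 Ψ

  Fr : Functor ∫Ψ ∫Ψ⋉𝐲U
  Fr = record
    { F₀ = λ { (W , ψ) → M.F₀ W , (W , 𝒱.id , ψ) }
    ; F₁ = λ { {W , ψ} {W' , ψ'} (f , p) →
               M.F₁ f ,
               EqC.symmetric Step
                 (fwd (elem (Ψ.F₀.sym W p)) ◅ fwd (zig f ψ' (𝒱.Equiv.trans 𝒱.identityˡ (𝒱.Equiv.sym 𝒱.identityʳ))) ◅ ε) }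
    ; identity = M.identity
    ; homomorphism = M.homomorphism
    ; F-resp-≈ = M.F-resp-≈ }
  private
    module Fr = Functor Fr
    module ∫V = Category ∫Ψ⋉𝐲U

  -- The transpension  T^Ψ_U Γ ,  (T Γ)(V , φ) = Hom((Fr)^* 𝐲(V , φ) , Γ)
  T : Presheaf ∫Ψ → Presheaf ∫Ψ⋉𝐲U
  T Γ = record
    { F₀ = λ c → PshHom ((Fr ^*) (𝐲 c)) Γ
    ; act = λ {c} {c'} h α → record
        { η = λ d g → NatTrans.η α d (h ∫V.∘ g)
        ; η-cong = λ d {g} {g'} p → NatTrans.η-cong α d (∫V.∘-resp-≈ {Fr.F₀ d} {c} {c'} {h} {h} {g} {g'} (∫V.Equiv.refl {x = h}) p)
        ; natural = λ {d} {d'} f g → Γ.F₀.trans d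
            (NatTrans.η-cong α d (∫V.Equiv.sym {x = (h ∫V.∘ g) ∫V.∘ Fr.F₁ f} {y = h ∫V.∘ (g ∫V.∘ Fr.F₁ f)} (∫V.assoc {f = Fr.F₁ f} {g = g} {h = h})))
            (NatTrans.natural α f (h ∫V.∘ g)) }
    ; act-cong = λ {c} {c'} h p d g → p d (h ∫V.∘ g)
    ; act-resp-≈ = λ {c} {c'} {h} {h'} α p d g → NatTrans.η-cong α d (∫V.∘-resp-≈ {Fr.F₀ d} {c} {c'} {h} {h'} {g} {g} p (∫V.Equiv.refl {x = g}))
    ; act-id = λ {c} α d g → NatTrans.η-cong α d (∫V.identityˡ {Fr.F₀ d} {c} {g})
    ; act-∘ = λ f g α d k → NatTrans.η-cong α d (∫V.assoc {f = k} {g = f} {h = g}) }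
    where module Γ = Presheaf Γ

module Submission where

open import Defs
open import Level using (Level)
open import Data.Empty using (⊥-elim)
open import Data.Product using (_,_)
open import Relation.Nullary using (¬_)
open import Relation.Binary.Bundles using (Setoid)
import Relation.Binary.Construct.Closure.Equivalence as EqC
open import Relation.Binary.Reasoning.Setoid as SetoidReasoning using ()

-- A morphism  Fr(W , ψ) → (V , φ)  in  ∫(Ψ ⋉ 𝐲U)  is a  χ : W ⋉ U → V  with
-- φ ∘ χ = (ψ ⋉ 𝐲U) ∘ id;  applying  π₂  gives  π₂ ∘ φ ∘ χ = π₂,  so  π₂ ∘ φ  is
-- dimensionally split.  Over the boundary the presheaf  Fr^* 𝐲(V , φ)  is therefore
-- empty, and the only natural transformation out of an empty presheaf is the
-- empty one.

module _ {ℓ : Level} {C : Category ℓ} where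

  PshHom-from-empty-isSingleton : (P Q : Presheaf C) →
    (∀ A → ¬ Presheaf.∣_∣ P A) → IsSingleton (PshHom P Q)
  PshHom-from-empty-isSingleton P Q empty = emptyNat , λ _ A x → ⊥-elim (empty A x)
    where
      emptyNat : NatTrans P Q
      emptyNat = record
        { η       = λ A x → ⊥-elim (empty A x)
        ; η-cong  = λ A {x} _ → ⊥-elim (empty A x)
        ; natural = λ {_} {B} _ x → ⊥-elim (empty B x) }

module _ {ℓ : Level} {𝒲 : Category ℓ} {⊤𝒲 : Terminal 𝒲} {𝒱 : Category ℓ}
         {U : Category.Obj 𝒱} (M : Multiplier 𝒲 ⊤𝒲 𝒱 U) where
  private
    module 𝒲 = Category 𝒲
    module 𝒱 = Category 𝒱
    module M = Multiplier M
  open Terminal ⊤𝒲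

  π₂-natural : ∀ {W W'} (f : W 𝒲.⇒ W') → π₂ M W' 𝒱.∘ M.F₁ f 𝒱.≈ π₂ M W
  π₂-natural {W} f = begin
    (M.from 𝒱.∘ M.F₁ !) 𝒱.∘ M.F₁ f ≈⟨ 𝒱.assoc ⟩
    M.from 𝒱.∘ (M.F₁ ! 𝒱.∘ M.F₁ f) ≈⟨ 𝒱.∘-resp-≈ 𝒱.Equiv.refl (𝒱.Equiv.sym M.homomorphism) ⟩
    M.from 𝒱.∘ M.F₁ (! 𝒲.∘ f)      ≈⟨ 𝒱.∘-resp-≈ 𝒱.Equiv.refl (M.F-resp-≈ (𝒲.Equiv.sym (!-unique (! 𝒲.∘ f)))) ⟩
    M.from 𝒱.∘ M.F₁ !              ∎
    where open SetoidReasoning (𝒱.hom-setoid (M.F₀ W) U)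

  module _ (Ψ : Presheaf 𝒲) where
    open Transpension M Ψ

    π₂ᶜ-resp-Step : ∀ {V} {x y : Rep V} → Step x y → π₂ᶜ x 𝒱.≈ π₂ᶜ y
    π₂ᶜ-resp-Step (hom p)  = 𝒱.∘-resp-≈ 𝒱.Equiv.refl p
    π₂ᶜ-resp-Step (elem _) = 𝒱.Equiv.refl
    π₂ᶜ-resp-Step {V} (zig {W} {W'} f {χ} {χ'} _ p) = 𝒱.Equiv.sym (begin
      π₂ M W' 𝒱.∘ χ'                ≈⟨ 𝒱.∘-resp-≈ 𝒱.Equiv.refl p ⟩
      π₂ M W' 𝒱.∘ (M.F₁ f 𝒱.∘ χ)   ≈⟨ 𝒱.Equiv.sym 𝒱.assoc ⟩
      (π₂ M W' 𝒱.∘ M.F₁ f) 𝒱.∘ χ   ≈⟨ 𝒱.∘-resp-≈ (π₂-natural f) 𝒱.Equiv.refl ⟩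
      π₂ M W 𝒱.∘ χ                  ∎)
      where open SetoidReasoning (𝒱.hom-setoid V U)

    π₂ᶜ-resp-Coend : ∀ {V} {x y : Rep V} → Setoid._≈_ (Coend V) x y → π₂ᶜ x 𝒱.≈ π₂ᶜ y
    π₂ᶜ-resp-Coend = EqC.gfold 𝒱.equiv π₂ᶜ π₂ᶜ-resp-Step

    Fr-hom⇒dimensionallySplit : ∀ d V (φ : Rep V) →
      Category._⇒_ ∫Ψ⋉𝐲U (Functor.F₀ Fr d) (V , φ) → DimensionallySplit M (π₂ᶜ φ)
    Fr-hom⇒dimensionallySplit (W , ψ) V φ (χ , φχ≈ψ) = W , χ , (begin
      π₂ᶜ φ 𝒱.∘ χ                  ≈⟨ 𝒱.assoc ⟩
      π₂ᶜ (Presheaf.act Ψ⋉𝐲U χ φ)  ≈⟨ π₂ᶜ-resp-Coend φχ≈ψ ⟩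
      π₂ M W 𝒱.∘ 𝒱.id              ≈⟨ 𝒱.identityʳ ⟩
      π₂ M W                       ∎)
      where open SetoidReasoning (𝒱.hom-setoid (M.F₀ W) U)

mainTheorem1 : ∀ {ℓ : Level} (𝒲 : Category ℓ) (⊤𝒲 : Terminal 𝒲) (𝒱 : Category ℓ)
    (U : Category.Obj 𝒱) (M : Multiplier 𝒲 ⊤𝒲 𝒱 U) → NonSpooky M →
    (Ψ : Presheaf 𝒲) (Γ : Presheaf (Transpension.∫Ψ M Ψ)) →
    IsTerminalPsh ((Transpension.ι∂ M Ψ ^*) (Transpension.T M Ψ Γ))
mainTheorem1 𝒲 ⊤𝒲 𝒱 U M _ Ψ Γ ((V , φ) , notSplit) =
  PshHom-from-empty-isSingleton ((Fr ^*) (𝐲 (V , φ))) Γ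
    (λ d g → notSplit (Fr-hom⇒dimensionallySplit M Ψ d V φ g))
  where open Transpension M Ψ
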